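{- For every semigroup $S$, the girth of the inclusion ideal graph satisfies $g(\mathcal{I}n(S))\in\{3,6,\infty\}$.
   Context: A left ideal of a semigroup $S$ is a non-empty subset $I$ with $SI\subseteq I$; it is nontrivial if $I\neq S$. The inclusion ideal graph $\mathcal{I}n(S)$ is the simple undirected graph whose vertices are the nontrivial left ideals of $S$, with distinct $I,J$ adjacent iff $I\subset J$ or $J\subset I$. The girth is the length of a shortest cycle, and is $\infty$ if the graph has no cycle. -}

module Defs where

open import Level using (Level; _⊔_; suc)
open import Algebra.Bundles using (Semigroup)
open import Data.Nat as ℕ using (ℕ; _<_; _≤_)
open import Data.Nat.DivMod using (_%_; m%n<n)
open import Data.Fin using (Fin; toℕ; fromℕ<)
open import Data.Maybe using (Maybe; just; nothing)
open import Data.Product using (Σ; ∃; _×_; _,_)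
open import Data.Sum using (_⊎_)
open import Relation.Nullary using (¬_)
open import Relation.Unary using (Pred; _∈_; _⊆_)
open import Relation.Binary.Definitions using (_Respects_)
open import Relation.Binary.PropositionalEquality using (_≡_)

module _ {c ℓ : Level} (S : Semigroup c ℓ) where
  open Semigroup S

  record Subset : Set (suc (c ⊔ ℓ)) where
    field
      pred    : Pred Carrier (c ⊔ ℓ)
      respect : pred Respects _≈_
  open Subset public

  _≐_ : Subset → Subset → Set (c ⊔ ℓ)
  A ≐ B = (pred A ⊆ pred B) × (pred B ⊆ pred A)

  _⊂_ : Subset → Subset → Set (c ⊔ ℓ)
  A ⊂ B = (pred A ⊆ pred B) × ¬ (pred B ⊆ pred A)

  IsLeftIdeal : Subset → Set (c ⊔ ℓ)
  IsLeftIdeal I = (∃ λ x → x ∈ pred I) × (∀ s x → x ∈ pred I → (s ∙ x) ∈ pred I)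

  IsNontrivial : Subset → Set (c ⊔ ℓ)
  IsNontrivial I = ¬ (∀ x → x ∈ pred I)

  Vertex : Set (suc (c ⊔ ℓ))
  Vertex = Σ Subset λ I → IsLeftIdeal I × IsNontrivial I

  carrierOf : Vertex → Subset
  carrierOf (I , _) = I

  Adj : Vertex → Vertex → Set (c ⊔ ℓ)
  Adj I J = ¬ (carrierOf I ≐ carrierOf J)
          × ((carrierOf I ⊂ carrierOf J) ⊎ (carrierOf J ⊂ carrierOf I))

  next : {m : ℕ} → Fin (ℕ.suc m) → Fin (ℕ.suc m)
  next {m} i = fromℕ< (m%n<n (ℕ.suc (toℕ i)) (ℕ.suc m))

  HasCycleOfLength : ℕ → Set (suc (c ⊔ ℓ))
  HasCycleOfLength ℕ.zero = Level.Lift _ (Data.Empty.⊥)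
    where import Data.Empty
  HasCycleOfLength (ℕ.suc m) =
    (3 ≤ ℕ.suc m) ×
    (Σ (Fin (ℕ.suc m) → Vertex) λ v →
        (∀ i j → carrierOf (v i) ≐ carrierOf (v j) → i ≡ j)
      × (∀ i → Adj (v i) (v (next i))))

  -- The girth of In(S) equals g (nothing = ∞).
  IsGirth : Maybe ℕ → Set (suc (c ⊔ ℓ))
  IsGirth (just n) = HasCycleOfLength n × (∀ m → m < n → ¬ HasCycleOfLength m)
  IsGirth nothing  = ∀ m → ¬ HasCycleOfLength m

-- If In(S) contains a triangle its girth is 3. Otherwise no three vertices
-- form a chain A ⊂ B ⊂ C (a chain is a triangle), so the inclusions along any
-- cycle alternate in direction and a cycle has length at least 4. A 4-cycle
-- A ⊂ T ⊃ B ⊂ T′ ⊃ A cannot exist: A ∪ B is a left ideal with A ⊂ A ∪ B ⊆ T ∩ T′,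
-- so A ∪ B = T = T′. A 5-cycle is ruled out by parity. A longer cycle contains
-- a zigzag A₁ ⊂ T₁ ⊃ A₂ ⊂ T₂ ⊃ A₃; distinct lower vertices are disjoint (their
-- intersection would lie strictly below one of them), so A₁ ∪ A₃ misses A₂ and
-- A₁, T₁, A₂, T₂, A₃, A₁ ∪ A₃ is a 6-cycle.

module Submission where

open import Level using (Level; _⊔_; lift)
open import Algebra.Bundles using (Semigroup)
open import Data.Empty using (⊥; ⊥-elim)
open import Data.Fin using (Fin; zero; suc; combine; remQuot)
open import Data.Fin.Properties using (combine-remQuot)
open import Data.Maybe using (just; nothing)
open import Data.Nat using (ℕ; zero; suc; _<_; _≤_; _*_; _<?_; z≤n; s≤s; z<s; s<s)
open import Data.Nat.Properties using (<⇒≱; ≮⇒≥)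
open import Data.Product as Product using (∃; _×_; _,_; proj₁; proj₂; uncurry)
open import Data.Sum as Sum using (_⊎_; inj₁; inj₂; [_,_])
open import Data.Vec.Functional using (_∷_; [])
open import Function using (_∘_)
open import Relation.Nullary using (¬_; yes; no)
open import Relation.Unary using (Pred; _∈_; _⊆_)
open import Relation.Binary.PropositionalEquality using (_≡_; _≢_; refl; cong; module ≡-Reasoning)

open import Defs

module InclusionIdealGraph {c ℓ : Level} (S : Semigroup c ℓ) where
  open Semigroup S using (Carrier)

  private
    variable
      m n : ℕ
      x : Carrier
      I J : Subset S
      A B C T T′ A₁ A₂ A₃ T₁ T₂ : Vertex S

  ⟦_⟧ : Vertex S → Pred Carrier (c ⊔ ℓ)
  ⟦ A ⟧ = pred (carrierOf S A)

  infix 4 _≈ᵥ_ _≉ᵥ_ _⊏_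

  record _≈ᵥ_ (A B : Vertex S) : Set (c ⊔ ℓ) where
    constructor antisym
    field
      included : ⟦ A ⟧ ⊆ ⟦ B ⟧
      includes : ⟦ B ⟧ ⊆ ⟦ A ⟧

  _≉ᵥ_ : Vertex S → Vertex S → Set (c ⊔ ℓ)
  A ≉ᵥ B = ¬ (A ≈ᵥ B)

  record _⊏_ (A B : Vertex S) : Set (c ⊔ ℓ) where
    constructor proper
    field
      included    : ⟦ A ⟧ ⊆ ⟦ B ⟧
      nonincludes : ¬ (⟦ B ⟧ ⊆ ⟦ A ⟧)

  Injectiveᵥ : (Fin n → Vertex S) → Set (c ⊔ ℓ)
  Injectiveᵥ v = ∀ i j → _≐_ S (carrierOf S (v i)) (carrierOf S (v j)) → i ≡ j

  injective⇒distinct : {v : Fin n → Vertex S} → Injectiveᵥ v →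
                       ∀ {i j} → i ≢ j → v i ≉ᵥ v j
  injective⇒distinct inj i≢j (antisym to from) = i≢j (inj _ _ (to , from))

  ≉ᵥ-sym : A ≉ᵥ B → B ≉ᵥ A
  ≉ᵥ-sym A≉B (antisym B⊆A A⊆B) = A≉B (antisym A⊆B B⊆A)

  ⊏-trans : A ⊏ B → B ⊏ C → A ⊏ C
  ⊏-trans (proper A⊆B B⊈A) (proper B⊆C C⊈B) = proper (B⊆C ∘ A⊆B) (λ C⊆A → C⊈B (A⊆B ∘ C⊆A))

  ⊏-asym : A ⊏ B → ¬ B ⊏ A
  ⊏-asym (proper _ B⊈A) (proper B⊆A _) = B⊈A B⊆A

  ⊏⇒≉ᵥ : A ⊏ B → A ≉ᵥ B
  ⊏⇒≉ᵥ (proper _ B⊈A) (antisym _ B⊆A) = B⊈A B⊆A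

  ⊏⇒Adj : A ⊏ B → Adj S A B
  ⊏⇒Adj A⊏B@(proper A⊆B B⊈A) = (λ (A⊆B , B⊆A) → ⊏⇒≉ᵥ A⊏B (antisym A⊆B B⊆A)) , inj₁ (A⊆B , B⊈A)

  ⊐⇒Adj : B ⊏ A → Adj S A B
  ⊐⇒Adj B⊏A@(proper B⊆A A⊈B) = (λ (A⊆B , B⊆A) → ⊏⇒≉ᵥ B⊏A (antisym B⊆A A⊆B)) , inj₂ (B⊆A , A⊈B)

  nonempty : (A : Vertex S) → ∃ ⟦ A ⟧
  nonempty (_ , (inhabited , _) , _) = inhabited

  isNontrivial : (A : Vertex S) → IsNontrivial S (carrierOf S A)
  isNontrivial (_ , _ , A≠S) = A≠S

  _∪_ _∩_ : Subset S → Subset S → Subset S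
  I ∪ J = record
    { pred    = λ x → pred I x ⊎ pred J x
    ; respect = λ x≈y → Sum.map (respect I x≈y) (respect J x≈y)
    }
  I ∩ J = record
    { pred    = λ x → pred I x × pred J x
    ; respect = λ x≈y → Product.map (respect I x≈y) (respect J x≈y)
    }

  ∪-isLeftIdeal : IsLeftIdeal S I → IsLeftIdeal S J → IsLeftIdeal S (I ∪ J)
  ∪-isLeftIdeal ((x , x∈I) , I-closed) (_ , J-closed) =
    (x , inj₁ x∈I) , λ s y → Sum.map (I-closed s y) (J-closed s y)

  ∩-isLeftIdeal : IsLeftIdeal S I → IsLeftIdeal S J →
                  x ∈ pred I → x ∈ pred J → IsLeftIdeal S (I ∩ J)
  ∩-isLeftIdeal (_ , I-closed) (_ , J-closed) x∈I x∈J =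
    (_ , x∈I , x∈J) , λ s y → Product.map (I-closed s y) (J-closed s y)

  union : (A B : Vertex S) → IsNontrivial S (carrierOf S A ∪ carrierOf S B) → Vertex S
  union (I , I-ideal , _) (J , J-ideal , _) I∪J≠S = I ∪ J , ∪-isLeftIdeal {I} {J} I-ideal J-ideal , I∪J≠S

  meet : (A B : Vertex S) → x ∈ ⟦ A ⟧ → x ∈ ⟦ B ⟧ → Vertex S
  meet (I , I-ideal , I≠S) (J , J-ideal , _) x∈I x∈J =
    I ∩ J , ∩-isLeftIdeal {I = I} {J} I-ideal J-ideal x∈I x∈J , λ I∩J=S → I≠S (proj₁ ∘ I∩J=S)

  cycle-length≥3 : HasCycleOfLength S m → 3 ≤ m
  cycle-length≥3 {zero}  (lift ())
  cycle-length≥3 {suc m} (3≤m , _) = 3≤m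

  no-cycle-below-3 : ∀ m → m < 3 → ¬ HasCycleOfLength S m
  no-cycle-below-3 m m<3 = <⇒≱ m<3 ∘ cycle-length≥3

  triple-injective : A ≉ᵥ B → A ≉ᵥ C → B ≉ᵥ C → Injectiveᵥ (A ∷ B ∷ C ∷ [])
  triple-injective {A} {B} {C} A≉B A≉C B≉C i j (to , from) = triple i j (antisym to from)
    where
    triple : ∀ i j → (A ∷ B ∷ C ∷ []) i ≈ᵥ (A ∷ B ∷ C ∷ []) j → i ≡ j
    triple = λ where
      zero             zero             _ → refl
      zero             (suc zero)       e → ⊥-elim (A≉B e)
      zero             (suc (suc zero)) e → ⊥-elim (A≉C e)
      (suc zero)       zero             e → ⊥-elim (≉ᵥ-sym A≉B e)
      (suc zero)       (suc zero)       _ → refl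
      (suc zero)       (suc (suc zero)) e → ⊥-elim (B≉C e)
      (suc (suc zero)) zero             e → ⊥-elim (≉ᵥ-sym A≉C e)
      (suc (suc zero)) (suc zero)       e → ⊥-elim (≉ᵥ-sym B≉C e)
      (suc (suc zero)) (suc (suc zero)) _ → refl

  chain⇒triangle : A ⊏ B → B ⊏ C → HasCycleOfLength S 3
  chain⇒triangle {A} {B} {C} A⊏B B⊏C =
    s≤s (s≤s (s≤s z≤n)) , (A ∷ B ∷ C ∷ []) ,
    triple-injective (⊏⇒≉ᵥ A⊏B) (⊏⇒≉ᵥ A⊏C) (⊏⇒≉ᵥ B⊏C) ,
    λ where
      zero             → ⊏⇒Adj A⊏B
      (suc zero)       → ⊏⇒Adj B⊏C
      (suc (suc zero)) → ⊐⇒Adj A⊏C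
    where
    A⊏C : A ⊏ C
    A⊏C = ⊏-trans A⊏B B⊏C

  -- interleave lo hi lists lo 0, hi 0, lo 1, hi 1, …; the index k is decoded as
  -- remQuot 2 k = (k / 2 , k % 2).
  select : (Fin n → Vertex S) → (Fin n → Vertex S) → Fin n × Fin 2 → Vertex S
  select lo hi (i , zero)     = lo i
  select lo hi (i , suc zero) = hi i

  select-injective : {lo hi : Fin n → Vertex S} →
                     Injectiveᵥ lo → Injectiveᵥ hi → (∀ i j → lo i ≉ᵥ hi j) →
                     ∀ p q → _≐_ S (carrierOf S (select lo hi p)) (carrierOf S (select lo hi q)) → p ≡ q
  select-injective lo-inj hi-inj lo≉hi = λ where
    (i , zero)     (j , zero)     e           → cong (_, zero) (lo-inj i j e)
    (i , zero)     (j , suc zero) (to , from) → ⊥-elim (lo≉hi i j (antisym to from))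
    (i , suc zero) (j , zero)     (to , from) → ⊥-elim (lo≉hi j i (antisym from to))
    (i , suc zero) (j , suc zero) e           → cong (_, suc zero) (hi-inj i j e)

  remQuot-injective : ∀ (k k′ : Fin (n * 2)) → remQuot {n} 2 k ≡ remQuot 2 k′ → k ≡ k′
  remQuot-injective {n} k k′ eq = begin
    k                                  ≡⟨ combine-remQuot {n} 2 k ⟨
    uncurry combine (remQuot {n} 2 k)  ≡⟨ cong (uncurry combine) eq ⟩
    uncurry combine (remQuot {n} 2 k′) ≡⟨ combine-remQuot {n} 2 k′ ⟩
    k′                                 ∎
    where open ≡-Reasoning

  interleave : (Fin n → Vertex S) → (Fin n → Vertex S) → Fin (n * 2) → Vertex S
  interleave {n} lo hi = select lo hi ∘ remQuot {n} 2

  interleave-injective : {lo hi : Fin n → Vertex S} →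
                         Injectiveᵥ lo → Injectiveᵥ hi → (∀ i j → lo i ≉ᵥ hi j) →
                         Injectiveᵥ (interleave lo hi)
  interleave-injective lo-inj hi-inj lo≉hi k k′ =
    remQuot-injective k k′ ∘ select-injective lo-inj hi-inj lo≉hi (remQuot 2 k) (remQuot 2 k′)

  module TriangleFree (no-triangle : ¬ HasCycleOfLength S 3) where

    no-chain : A ⊏ B → B ⊏ C → ⊥
    no-chain A⊏B B⊏C = no-triangle (chain⇒triangle A⊏B B⊏C)

    lower≉upper : A ⊏ T′ → B ⊏ T → A ≉ᵥ T
    lower≉upper {B = B} A⊏T′ (proper B⊆T T⊈B) (antisym A⊆T T⊆A) =
      no-chain {B} (proper (T⊆A ∘ B⊆T) (λ A⊆B → T⊈B (A⊆B ∘ T⊆A))) A⊏T′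

    lower⊆upper⇒⊏ : A ⊏ T′ → B ⊏ T → ⟦ A ⟧ ⊆ ⟦ T ⟧ → A ⊏ T
    lower⊆upper⇒⊏ A⊏T′ B⊏T A⊆T = proper A⊆T (λ T⊆A → lower≉upper A⊏T′ B⊏T (antisym A⊆T T⊆A))

    lowers-disjoint : A ≉ᵥ B → A ⊏ T → B ⊏ T′ → x ∈ ⟦ A ⟧ → x ∈ ⟦ B ⟧ → ⊥
    lowers-disjoint {A} {B} A≉B A⊏T B⊏T′ x∈A x∈B =
      no-chain {M} (proper proj₁ λ A⊆M →
        no-chain {M} (proper proj₂ λ B⊆M →
          A≉B (antisym (proj₂ ∘ A⊆M) (proj₁ ∘ B⊆M)))
        B⊏T′)
      A⊏T
      where
      M : Vertex S
      M = meet A B x∈A x∈B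

    no-square : A ≉ᵥ B → T ≉ᵥ T′ → A ⊏ T → B ⊏ T → A ⊏ T′ → B ⊏ T′ → ⊥
    no-square {A} {B} {T} {T′} A≉B T≉T′ A⊏T B⊏T A⊏T′ B⊏T′ =
      no-chain A⊏U (proper {U} {T} U⊆T λ T⊆U →
        no-chain A⊏U (proper {U} {T′} U⊆T′ λ T′⊆U →
          T≉T′ (antisym (U⊆T′ ∘ T⊆U) (U⊆T ∘ T′⊆U))))
      where
      U⊆T : ∀ {x} → x ∈ ⟦ A ⟧ ⊎ x ∈ ⟦ B ⟧ → x ∈ ⟦ T ⟧
      U⊆T = [ _⊏_.included A⊏T , _⊏_.included B⊏T ]
      U⊆T′ : ∀ {x} → x ∈ ⟦ A ⟧ ⊎ x ∈ ⟦ B ⟧ → x ∈ ⟦ T′ ⟧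
      U⊆T′ = [ _⊏_.included A⊏T′ , _⊏_.included B⊏T′ ]
      U : Vertex S
      U = union A B λ U=S → isNontrivial T (U⊆T ∘ U=S)
      A⊏U : A ⊏ U
      A⊏U = proper inj₁ λ U⊆A →
        no-chain {B} (proper (U⊆A ∘ inj₂) λ A⊆B → A≉B (antisym A⊆B (U⊆A ∘ inj₂))) A⊏T

    hexagon : A₁ ≉ᵥ A₂ → A₁ ≉ᵥ A₃ → A₂ ≉ᵥ A₃ → T₁ ≉ᵥ T₂ →
              A₁ ⊏ T₁ → A₂ ⊏ T₁ → A₂ ⊏ T₂ → A₃ ⊏ T₂ → HasCycleOfLength S 6
    hexagon {A₁} {A₂} {A₃} {T₁} {T₂} A₁≉A₂ A₁≉A₃ A₂≉A₃ T₁≉T₂ A₁⊏T₁ A₂⊏T₁ A₂⊏T₂ A₃⊏T₂ =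
      s≤s (s≤s (s≤s z≤n)) , interleave lo hi ,
      interleave-injective (triple-injective A₁≉A₂ A₁≉A₃ A₂≉A₃) (triple-injective T₁≉T₂ T₁≉W T₂≉W)
                           (λ i j → lower≉upper (lo⊏hi i) (lo⊏hi j)) ,
      λ where
        zero                                → ⊏⇒Adj A₁⊏T₁
        (suc zero)                          → ⊐⇒Adj A₂⊏T₁
        (suc (suc zero))                    → ⊏⇒Adj A₂⊏T₂
        (suc (suc (suc zero)))              → ⊐⇒Adj A₃⊏T₂
        (suc (suc (suc (suc zero))))        → ⊏⇒Adj A₃⊏W
        (suc (suc (suc (suc (suc zero))))) → ⊐⇒Adj A₁⊏W
      where
      A₂-disjoint : x ∈ ⟦ A₂ ⟧ → ¬ (x ∈ ⟦ A₁ ⟧ ⊎ x ∈ ⟦ A₃ ⟧)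
      A₂-disjoint x∈A₂ = [ (λ x∈A₁ → lowers-disjoint A₁≉A₂ A₁⊏T₁ A₂⊏T₁ x∈A₁ x∈A₂)
                         , (λ x∈A₃ → lowers-disjoint (≉ᵥ-sym A₂≉A₃) A₃⊏T₂ A₂⊏T₂ x∈A₃ x∈A₂) ]

      W : Vertex S
      W = union A₁ A₃ λ W=S → let (x , x∈A₂) = nonempty A₂ in A₂-disjoint x∈A₂ (W=S x)

      A₁⊏W : A₁ ⊏ W
      A₁⊏W = proper inj₁ λ W⊆A₁ →
        let (x , x∈A₃) = nonempty A₃ in lowers-disjoint A₁≉A₃ A₁⊏T₁ A₃⊏T₂ (W⊆A₁ (inj₂ x∈A₃)) x∈A₃

      A₃⊏W : A₃ ⊏ W
      A₃⊏W = proper inj₂ λ W⊆A₃ →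
        let (x , x∈A₁) = nonempty A₁ in lowers-disjoint A₁≉A₃ A₁⊏T₁ A₃⊏T₂ x∈A₁ (W⊆A₃ (inj₁ x∈A₁))

      T₁≉W : T₁ ≉ᵥ W
      T₁≉W (antisym _ W⊆T₁) =
        no-square A₂≉A₃ T₁≉T₂ A₂⊏T₁ (lower⊆upper⇒⊏ A₃⊏T₂ A₁⊏T₁ (W⊆T₁ ∘ inj₂)) A₂⊏T₂ A₃⊏T₂

      T₂≉W : T₂ ≉ᵥ W
      T₂≉W (antisym _ W⊆T₂) =
        no-square A₁≉A₂ T₁≉T₂ A₁⊏T₁ A₂⊏T₁ (lower⊆upper⇒⊏ A₁⊏T₁ A₃⊏T₂ (W⊆T₂ ∘ inj₁)) A₂⊏T₂

      lo hi : Fin 3 → Vertex S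
      lo = A₁ ∷ A₂ ∷ A₃ ∷ []
      hi = T₁ ∷ T₂ ∷ W ∷ []

      lo⊏hi : ∀ i → lo i ⊏ hi i
      lo⊏hi zero             = A₁⊏T₁
      lo⊏hi (suc zero)       = A₂⊏T₂
      lo⊏hi (suc (suc zero)) = A₃⊏W

    module Alternation (v : Fin (suc m) → Vertex S) (adj : ∀ i → Adj S (v i) (v (next S i))) where

      Ascent Descent : Fin (suc m) → Set (c ⊔ ℓ)
      Ascent  i = v i ⊏ v (next S i)
      Descent i = v (next S i) ⊏ v i

      ascent⊎descent : ∀ i → Ascent i ⊎ Descent i
      ascent⊎descent i with proj₂ (adj i)
      ... | inj₁ (v⊆v′ , v′⊈v) = inj₁ (proper v⊆v′ v′⊈v)
      ... | inj₂ (v′⊆v , v⊈v′) = inj₂ (proper v′⊆v v⊈v′)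

      ascent⇒descent : ∀ {i} → Ascent i → Descent (next S i)
      ascent⇒descent {i} up with ascent⊎descent (next S i)
      ... | inj₁ up′  = ⊥-elim (no-chain up up′)
      ... | inj₂ down = down

      descent⇒ascent : ∀ {i} → Descent i → Ascent (next S i)
      descent⇒ascent {i} down with ascent⊎descent (next S i)
      ... | inj₁ up    = up
      ... | inj₂ down′ = ⊥-elim (no-chain down′ down)

    no-cycle-4 : ¬ HasCycleOfLength S 4
    no-cycle-4 (_ , v , inj , adj) = [ ascending , descending ] (ascent⊎descent zero)
      where
      open Alternation v adj
      distinct : ∀ {i j} → i ≢ j → v i ≉ᵥ v j
      distinct = injective⇒distinct inj
      ascending : Ascent zero → ⊥
      ascending a₀ = no-square (distinct (λ ())) (distinct (λ ())) a₀ d₁ d₃ a₂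
        where
        d₁ : Descent (suc zero)
        d₁ = ascent⇒descent a₀
        a₂ : Ascent (suc (suc zero))
        a₂ = descent⇒ascent d₁
        d₃ : Descent (suc (suc (suc zero)))
        d₃ = ascent⇒descent a₂
      descending : Descent zero → ⊥
      descending d₀ = no-square (distinct (λ ())) (distinct (λ ())) d₀ a₃ a₁ d₂
        where
        a₁ : Ascent (suc zero)
        a₁ = descent⇒ascent d₀
        d₂ : Descent (suc (suc zero))
        d₂ = ascent⇒descent a₁
        a₃ : Ascent (suc (suc (suc zero)))
        a₃ = descent⇒ascent d₂

    no-cycle-5 : ¬ HasCycleOfLength S 5
    no-cycle-5 (_ , v , _ , adj) = [ ascending , descending ] (ascent⊎descent zero)
      where
      open Alternation v adj
      ascending : Ascent zero → ⊥
      ascending a₀ = ⊏-asym a₀ (ascent⇒descent (descent⇒ascent (ascent⇒descent (descent⇒ascent (ascent⇒descent a₀)))))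
      descending : Descent zero → ⊥
      descending d₀ = ⊏-asym (descent⇒ascent (ascent⇒descent (descent⇒ascent (ascent⇒descent (descent⇒ascent d₀))))) d₀

    long-cycle⇒hexagon : 6 ≤ m → HasCycleOfLength S m → HasCycleOfLength S 6
    long-cycle⇒hexagon (s≤s (s≤s (s≤s (s≤s (s≤s (s≤s _)))))) (_ , v , inj , adj) =
      [ ascending , descending ] (ascent⊎descent zero)
      where
      open Alternation v adj
      distinct : ∀ {i j} → i ≢ j → v i ≉ᵥ v j
      distinct = injective⇒distinct inj
      ascending : Ascent zero → HasCycleOfLength S 6
      ascending a₀ = hexagon (distinct (λ ())) (distinct (λ ())) (distinct (λ ())) (distinct (λ ()))
                             a₀ d₁ a₂ d₃
        where
        d₁ : Descent (suc zero)
        d₁ = ascent⇒descent a₀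
        a₂ : Ascent (suc (suc zero))
        a₂ = descent⇒ascent d₁
        d₃ : Descent (suc (suc (suc zero)))
        d₃ = ascent⇒descent a₂
      descending : Descent zero → HasCycleOfLength S 6
      descending d₀ = hexagon (distinct (λ ())) (distinct (λ ())) (distinct (λ ())) (distinct (λ ()))
                              a₁ d₂ a₃ d₄
        where
        a₁ : Ascent (suc zero)
        a₁ = descent⇒ascent d₀
        d₂ : Descent (suc (suc zero))
        d₂ = ascent⇒descent a₁
        a₃ : Ascent (suc (suc (suc zero)))
        a₃ = descent⇒ascent d₂
        d₄ : Descent (suc (suc (suc (suc zero))))
        d₄ = ascent⇒descent a₃

    no-cycle-below-6 : ∀ m → m < 6 → ¬ HasCycleOfLength S m
    no-cycle-below-6 0 _ = no-cycle-below-3 0 z<s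
    no-cycle-below-6 1 _ = no-cycle-below-3 1 (s<s z<s)
    no-cycle-below-6 2 _ = no-cycle-below-3 2 (s<s (s<s z<s))
    no-cycle-below-6 3 _ = no-triangle
    no-cycle-below-6 4 _ = no-cycle-4
    no-cycle-below-6 5 _ = no-cycle-5
    no-cycle-below-6 (suc (suc (suc (suc (suc (suc _)))))) (s<s (s<s (s<s (s<s (s<s (s<s ()))))))

    cycle⇒hexagon : HasCycleOfLength S m → HasCycleOfLength S 6
    cycle⇒hexagon {m} cycle with m <? 6
    ... | yes m<6 = ⊥-elim (no-cycle-below-6 m m<6 cycle)
    ... | no m≮6  = long-cycle⇒hexagon (≮⇒≥ m≮6) cycle

    girth-six : HasCycleOfLength S m → IsGirth S (just 6)
    girth-six cycle = cycle⇒hexagon cycle , no-cycle-below-6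

-- The girth exists only classically, so the case split "triangle / some cycle /
-- no cycle" is made by refuting each alternative under the double negation.
mainTheorem4 : {c ℓ : Level} (S : Semigroup c ℓ) →
    ¬ ¬ (IsGirth S (just 3) ⊎ IsGirth S (just 6) ⊎ IsGirth S nothing)
mainTheorem4 S not-girth =
  not-girth (inj₂ (inj₂ λ _ cycle → not-girth (inj₂ (inj₁ (girth-six cycle)))))
  where
  open InclusionIdealGraph S
  no-triangle : ¬ HasCycleOfLength S 3
  no-triangle triangle = not-girth (inj₁ (triangle , no-cycle-below-3))
  open TriangleFree no-triangle
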